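{- Let $k\geq 3$ and $n_1,\dots,n_k\geq 2$, and let $K_{n_1,\dots,n_k}$ be the complete $k$-partite graph with parts of sizes $n_1,\dots,n_k$ (on a labeled vertex set). Then $$|\mathcal{O}(K_{n_1,\dots,n_k})| = \sum_{\substack{I\subseteq[k]\\ |I|\text{ even}}}\ \prod_{i\in I} n_i \;+\; \sum_{j=1}^k \prod_{i\in[k]\setminus\{j\}}(n_i+1),$$ where $[k]=\{1,\dots,k\}$ and the empty product (for $I=\emptyset$) equals $1$.
   Context: Local complement $c_v(G)$: replace the subgraph induced on the neighbourhood of vertex $v$ by its complement, leaving all other edges unchanged. The LC orbit $\mathcal{O}(G)$ is the set of labeled graphs on the vertex set of $G$ obtainable from $G$ by finite sequences of local complements (labeled graphs are counted as distinct even if isomorphic). The complete $k$-partite graph $K_{n_1,\dots,n_k}$ has vertex set $U_1\sqcup\cdots\sqcup U_k$ with $|U_i|=n_i$, with an edge between two vertices iff they lie in different parts. -}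

module Defs where

open import Data.Bool using (Bool; true; false; not; if_then_else_; _∧_)
open import Data.Nat using (ℕ; zero; suc; _+_; _*_; _%_)
open import Data.Nat.Properties using () renaming (_≟_ to _≟ℕ_)
open import Data.Fin using (Fin)
open import Data.Fin.Properties using () renaming (_≟_ to _≟F_)
open import Data.Fin.Subset using (Subset; Side; inside; outside; ∣_∣)
open import Data.Vec using ([]; _∷_; lookup)
open import Data.List using (List; []; _∷_; [_]; map; _++_; filter; allFin; length)
open import Data.Nat.ListAction using (sum; product)
open import Data.List.Relation.Unary.All using (All)
open import Data.List.Relation.Unary.Any using (Any)
open import Data.List.Relation.Unary.AllPairs using (AllPairs)
open import Data.Product using (Σ; _×_; _,_)
open import Data.Product.Properties using (≡-dec)
open import Relation.Nullary using (¬_; does)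
open import Relation.Binary.PropositionalEquality using (_≡_)

Graph : Set → Set
Graph V = V → V → Bool

SameGraph : {V : Set} → Graph V → Graph V → Set
SameGraph G H = ∀ x y → G x y ≡ H x y

-- Local complement at v: for distinct x, y both adjacent to v, toggle xy.
-- (Vertices of a simple graph are not adjacent to themselves, so the
-- neighbourhood of v never contains v.)
lc : {V : Set} → (dec : (a b : V) → Bool) → V → Graph V → Graph V
lc dec v G x y = if (not (dec x y) ∧ G v x ∧ G v y) then not (G x y) else G x y

data Reach {V : Set} (dec : (a b : V) → Bool) (G : Graph V) : Graph V → Set where
  base : Reach dec G G
  step : ∀ {H} (v : V) → Reach dec G H → Reach dec G (lc dec v H)

OrbitSize : {V : Set} → (dec : (a b : V) → Bool) → Graph V → ℕ → Set
OrbitSize {V} dec G m =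
  Σ (List (Graph V)) λ L →
    (length L ≡ m) ×
    All (Reach dec G) L ×
    AllPairs (λ A B → ¬ SameGraph A B) L ×
    (∀ H → Reach dec G H → Any (SameGraph H) L)

Vtx : (k : ℕ) → (Fin k → ℕ) → Set
Vtx k n = Σ (Fin k) (λ i → Fin (n i))

decVtx : (k : ℕ) (n : Fin k → ℕ) → Vtx k n → Vtx k n → Bool
decVtx k n x y = does (≡-dec _≟F_ _≟F_ x y)

completeMultipartite : (k : ℕ) (n : Fin k → ℕ) → Graph (Vtx k n)
completeMultipartite k n (i , _) (j , _) = not (does (i ≟F j))

Σ[i<_]_ : (k : ℕ) → (Fin k → ℕ) → ℕ
Σ[i< k ] f = sum (map f (allFin k))

Π[i<_]_ : (k : ℕ) → (Fin k → ℕ) → ℕ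
Π[i< k ] f = product (map f (allFin k))

allSubsets : (k : ℕ) → List (Subset k)
allSubsets zero = [ [] ]
allSubsets (suc k) = map (inside ∷_) (allSubsets k) ++ map (outside ∷_) (allSubsets k)

evenSubsets : (k : ℕ) → List (Subset k)
evenSubsets k = filter (λ I → (∣ I ∣ % 2) ≟ℕ 0) (allSubsets k)

prodOver : (k : ℕ) → Subset k → (Fin k → ℕ) → ℕ
prodOver k I n = Π[i< k ] (λ i → isIn (lookup I i) (n i))
  where
  isIn : Side → ℕ → ℕ
  isIn inside  a = a
  isIn outside _ = 1

orbitFormula : (k : ℕ) → (Fin k → ℕ) → ℕ
orbitFormula k n =
  sum (map (λ I → prodOver k I n) (evenSubsets k))
  + Σ[i< k ] (λ j → Π[i< k ] (λ i → if does (i ≟F j) then 1 else suc (n i)))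

-- Every graph in the local-complement orbit of K = K_{n_1,…,n_k} is described by a state of one
-- of two kinds. A multipartite state marks an even number of parts, each with one distinguished
-- vertex (its centre); its graph is complete multipartite on the non-leaf vertices, plus a star
-- from each centre to the other vertices (leaves) of its part. A hub state singles out a hub part
-- j and marks some of the other parts; its graph joins part j to every non-leaf vertex outside j,
-- makes each other part a clique (unmarked) or a star (marked), and makes part j a clique exactly
-- when an odd number of parts is marked. K is the multipartite state with nothing marked.
-- Local complementation at any vertex maps the graph of a state to the graph of another state;
-- whether it toggles an edge xy depends only on the roles of v, x, y and on which of them share
-- a part, so the rule can be checked by evaluation on finitely many snapshots. Every state is
-- reached: complementing K at a vertex of part j creates the hub j, complementing at a vertex of
-- an unmarked part marks it, and complementing at a hub vertex when an odd number of parts is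
-- marked gives back a multipartite state. For k ≥ 3 and all n_i ≥ 2 the graph determines the
-- state: leaves are the vertices without neighbours outside their part, the only neighbour of a
-- leaf inside its part is the centre, and in a hub state no two parts other than the hub are
-- adjacent, which separates hub states from multipartite ones and from hub states with another
-- hub. Counting states gives Σ_{|I| even} Π_{i∈I} n_i + Σ_j Π_{i≠j} (n_i + 1).

module Submission where

open import Defs
open import Data.Bool using (Bool; true; false; not; _∧_; _∨_; _xor_; if_then_else_; T)
open import Data.Bool.Properties
  using (T-∧; T?; xor-assoc; xor-comm; not-involutive; ∧-zeroʳ) renaming (_≟_ to _≟ᵇ_)
open import Data.Empty using (⊥-elim)
open import Data.Fin using (Fin; zero; suc; fromℕ<; punchIn; punchOut)
open import Data.Fin.Properties using (_≟_; suc-injective; punchInᵢ≢i; punchIn-injective; punchIn-punchOut)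
open import Data.Fin.Subset using (Subset; Side; inside; outside; ∣_∣)
open import Data.List using (List; []; _∷_; _++_; [_]; map; concatMap; allFin; length; cartesianProduct)
import Data.List as List
open import Data.List.Properties using (length-++; length-map; length-tabulate; map-tabulate; map-cong)
open import Data.List.Membership.Propositional using (_∈_; _∉_)
open import Data.List.Membership.Propositional.Properties
  using (∈-allFin; ∈-map⁺; ∈-++⁺ˡ; ∈-++⁺ʳ; ∈-filter⁺; ∈-cartesianProduct⁺)
open import Data.List.Relation.Unary.All as All using (All; []; _∷_)
import Data.List.Relation.Unary.All.Properties as Allₚ
open import Data.List.Relation.Unary.AllPairs as AllPairs using (AllPairs; []; _∷_)
import Data.List.Relation.Unary.AllPairs.Properties as AllPairsₚ
open import Data.List.Relation.Unary.Any as Any using (Any; here; there)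
import Data.List.Relation.Unary.Any.Properties as Anyₚ
open import Data.List.Relation.Unary.Unique.Propositional using (Unique)
import Data.List.Relation.Unary.Unique.Propositional.Properties as Uniqueₚ
open import Data.Maybe using (Maybe; just; nothing; is-just; fromMaybe)
open import Data.Maybe.Properties using (just-injective)
open import Data.Nat using (ℕ; zero; suc; _+_; _*_; _%_; _≤_; _<_; s≤s; z≤n)
open import Data.Nat.Properties using (≤-trans)
import Data.Nat as ℕ
open import Data.Nat.DivMod using (%-distribˡ-+)
open import Data.Nat.ListAction using (sum; product)
open import Data.Product using (∃; _×_; _,_; proj₁; proj₂)
open import Data.Product.Properties using (≡-dec)
open import Data.Unit using (tt)
open import Data.Vec using ([]; _∷_; lookup)
import Data.Vec as Vec
open import Data.Vec.Properties using (tabulate-cong; tabulate∘lookup; lookup∘tabulate; ∷-injectiveʳ)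
open import Function using (_∘_)
open import Function.Bundles using (Equivalence)
open import Relation.Binary.PropositionalEquality
  using (_≡_; _≢_; refl; sym; trans; cong; cong₂; subst; module ≡-Reasoning)
open import Relation.Nullary using (Dec; yes; no; does; ¬_; contradiction)
open import Relation.Nullary.Decidable using (True; isYes; toWitness; dec-true; dec-false)

private variable
  A B : Set
  k m : ℕ

does-sound : (d : Dec A) → T (does d) → A
does-sound (yes a) _ = a

does-complete : (d : Dec A) → A → T (does d)
does-complete (yes _) _ = tt
does-complete (no ¬a) a = ¬a a

_⇒_ : Bool → Bool → Bool
a ⇒ b = not a ∨ b

⇒-intro : ∀ {a b} → (T a → T b) → T (a ⇒ b)
⇒-intro {false} f = _
⇒-intro {true} f = f _

⇒-elim : ∀ {a b} → T (a ⇒ b) → T a → T b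
⇒-elim {true} t _ = t

∧-intro : ∀ {a b} → T a → T b → T (a ∧ b)
∧-intro p q = Equivalence.from T-∧ (p , q)

∧-elim : ∀ {a b} → T (a ∧ b) → T a × T b
∧-elim = Equivalence.to T-∧

record Finite (A : Set) : Set where
  field
    elements : List A
    complete : ∀ a → a ∈ elements

open Finite {{...}}

instance
  Bool-finite : Finite Bool
  Bool-finite = record
    { elements = true ∷ false ∷ []
    ; complete = λ { true → here refl ; false → there (here refl) } }

  ×-finite : {{Finite A}} → {{Finite B}} → Finite (A × B)
  ×-finite = record
    { elements = cartesianProduct elements elements
    ; complete = λ (a , b) → ∈-cartesianProduct⁺ (complete a) (complete b) }

by-exhaustion : {{_ : Finite A}} (p : A → Bool) → True (All.all? (T? ∘ p) elements) → ∀ a → T (p a)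
by-exhaustion p ok a = All.lookup (toWitness ok) (complete a)

fin-avoid : 2 ≤ m → (i : Fin m) → ∃ λ j → j ≢ i
fin-avoid (s≤s (s≤s _)) i = punchIn i zero , punchInᵢ≢i i zero

fin-avoid₂ : 3 ≤ m → (i i′ : Fin m) → ∃ λ j → j ≢ i × j ≢ i′
fin-avoid₂ {suc (suc (suc m))} (s≤s (s≤s (s≤s _))) i i′ with i ≟ i′
... | yes refl = punchIn i zero , punchInᵢ≢i i zero , punchInᵢ≢i i zero
... | no i≢i′ = punchIn i j₀ , punchInᵢ≢i i j₀ , λ eq →
    punchInᵢ≢i (punchOut i≢i′) zero (punchIn-injective i _ _ (trans eq (sym (punchIn-punchOut i≢i′))))
  where
  j₀ : Fin (suc (suc m))
  j₀ = punchIn (punchOut i≢i′) zero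

length-concatMap : (f : A → List B) (xs : List A) → length (concatMap f xs) ≡ sum (map (length ∘ f) xs)
length-concatMap f [] = refl
length-concatMap f (x ∷ xs) = trans (length-++ (f x)) (cong (length (f x) +_) (length-concatMap f xs))

length-concatMap-const : (f : A → List B) → (∀ x → length (f x) ≡ m) →
  ∀ xs → length (concatMap f xs) ≡ length xs * m
length-concatMap-const f eq [] = refl
length-concatMap-const f eq (x ∷ xs) =
  trans (length-++ (f x)) (cong₂ _+_ (eq x) (length-concatMap-const f eq xs))

AllPairs-concatMap : {R : B → B → Set} (f : A → List B) {xs : List A} → All (AllPairs R ∘ f) xs →
  AllPairs (λ x y → All (λ u → All (R u) (f y)) (f x)) xs → AllPairs R (concatMap f xs)
AllPairs-concatMap f within across = AllPairsₚ.concat⁺ (Allₚ.map⁺ within) (AllPairsₚ.map⁺ across)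

AllPairs-restrict : {P : A → Set} {R S : A → A → Set} {xs : List A} → All P xs → AllPairs R xs →
  (∀ {x y} → P x → P y → R x y → S x y) → AllPairs S xs
AllPairs-restrict [] [] f = []
AllPairs-restrict (px ∷ pxs) (rx ∷ rxs) f =
  All.zipWith (λ (py , r) → f px py r) (pxs , rx) ∷ AllPairs-restrict pxs rxs f

Π-tail : (f : Fin (suc k) → ℕ) → product (map f (List.tabulate suc)) ≡ Π[i< k ] (f ∘ suc)
Π-tail f = cong product (trans (map-tabulate suc f) (sym (map-tabulate (λ i → i) (f ∘ suc))))

_≐_ : {X : Fin k → Set} → ((i : Fin k) → X i) → ((i : Fin k) → X i) → Set
g ≐ h = ∀ i → g i ≡ h i

_∷ᶠ_ : {X : Fin (suc k) → Set} → X zero → ((i : Fin k) → X (suc i)) → (i : Fin (suc k)) → X i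
(x ∷ᶠ g) zero = x
(x ∷ᶠ g) (suc i) = g i

choiceFunctions : {X : Fin k → Set} → ((i : Fin k) → List (X i)) → List ((i : Fin k) → X i)
choiceFunctions {zero} e = [ (λ ()) ]
choiceFunctions {suc k} e = concatMap (λ x → map (x ∷ᶠ_) (choiceFunctions (e ∘ suc))) (e zero)

length-choiceFunctions : {X : Fin k → Set} (e : (i : Fin k) → List (X i)) →
  length (choiceFunctions e) ≡ Π[i< k ] (length ∘ e)
length-choiceFunctions {zero} e = refl
length-choiceFunctions {suc k} {X} e = trans
  (length-concatMap-const _ (λ x → trans (length-map (_∷ᶠ_ {X = X} x) (choiceFunctions (e ∘ suc)))
                                         (length-choiceFunctions (e ∘ suc))) (e zero))
  (cong (length (e zero) *_) (sym (Π-tail (length ∘ e))))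

choiceFunctions-all : {X : Fin k → Set} {P : (i : Fin k) → X i → Set} (e : (i : Fin k) → List (X i)) →
  (∀ i → All (P i) (e i)) → All (λ g → ∀ i → P i (g i)) (choiceFunctions e)
choiceFunctions-all {zero} e all = (λ ()) ∷ []
choiceFunctions-all {suc k} {X} {P} e all =
  Allₚ.concat⁺ (Allₚ.map⁺ (All.map (λ px → Allₚ.map⁺ (All.map (extend px) tails)) (all zero)))
  where
  tails : All (λ g → ∀ i → P (suc i) (g i)) (choiceFunctions (e ∘ suc))
  tails = choiceFunctions-all (e ∘ suc) (all ∘ suc)
  extend : ∀ {x g} → P zero x → (∀ i → P (suc i) (g i)) → ∀ i → P i (_∷ᶠ_ {X = X} x g i)
  extend px pg zero = px
  extend px pg (suc i) = pg i

choiceFunctions-complete : {X : Fin k → Set} (e : (i : Fin k) → List (X i)) (g : (i : Fin k) → X i) →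
  (∀ i → g i ∈ e i) → Any (g ≐_) (choiceFunctions e)
choiceFunctions-complete {zero} e g mem = here (λ ())
choiceFunctions-complete {suc k} e g mem =
  Anyₚ.concat⁺ (Anyₚ.map⁺ (Any.map (λ { refl → Anyₚ.map⁺ (Any.map agree tail) }) (mem zero)))
  where
  tail : Any ((g ∘ suc) ≐_) (choiceFunctions (e ∘ suc))
  tail = choiceFunctions-complete (e ∘ suc) (g ∘ suc) (mem ∘ suc)
  agree : ∀ {h} → (g ∘ suc) ≐ h → g ≐ (g zero ∷ᶠ h)
  agree eq zero = refl
  agree eq (suc i) = eq i

choiceFunctions-unique : {X : Fin k → Set} (e : (i : Fin k) → List (X i)) →
  (∀ i → Unique (e i)) → AllPairs (λ g h → ¬ g ≐ h) (choiceFunctions e)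
choiceFunctions-unique {zero} e unique = [] ∷ []
choiceFunctions-unique {suc k} {X} e unique =
  AllPairs-concatMap (λ x → map (x ∷ᶠ_) (choiceFunctions (e ∘ suc)))
    (All.universal (λ x → AllPairsₚ.map⁺ (AllPairs.map (λ g≉h eq → g≉h (eq ∘ suc)) tails)) (e zero))
    (AllPairs.map (λ x≢y → Allₚ.map⁺ (All.universal (λ _ →
                     Allₚ.map⁺ (All.universal (λ _ eq → x≢y (eq zero)) _)) _))
                  (unique zero))
  where
  tails : AllPairs (λ g h → ¬ g ≐ h) (choiceFunctions (e ∘ suc))
  tails = choiceFunctions-unique (e ∘ suc) (unique ∘ suc)

bit : Bool → ℕ
bit b = if b then 1 else 0

parity : Subset k → Bool
parity [] = false
parity (b ∷ I) = b xor parity I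

∣∣%2≡parity : (I : Subset k) → ∣ I ∣ % 2 ≡ bit (parity I)
∣∣%2≡parity [] = refl
∣∣%2≡parity (outside ∷ I) = ∣∣%2≡parity I
∣∣%2≡parity (inside ∷ I) =
  trans (%-distribˡ-+ 1 ∣ I ∣ 2) (trans (cong (λ r → (1 + r) % 2) (∣∣%2≡parity I)) (flip (parity I)))
  where
  flip : ∀ b → (1 + bit b) % 2 ≡ bit (not b)
  flip true = refl
  flip false = refl

even⇒parity-false : (I : Subset k) → ∣ I ∣ % 2 ≡ 0 → parity I ≡ false
even⇒parity-false I even with parity I | ∣∣%2≡parity I
... | false | _ = refl
... | true | odd with trans (sym even) odd
...   | ()

parity-false⇒even : (I : Subset k) → parity I ≡ false → ∣ I ∣ % 2 ≡ 0
parity-false⇒even I even = trans (∣∣%2≡parity I) (cong bit even)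

parity-empty : ∀ k → parity (Vec.tabulate {n = k} (λ _ → false)) ≡ false
parity-empty zero = refl
parity-empty (suc k) = parity-empty k

xor-cancel : ∀ a b c → b xor c ≡ (a xor b) xor (a xor c)
xor-cancel false b c = refl
xor-cancel true true c = refl
xor-cancel true false c = sym (not-involutive c)

xor-exchange : ∀ a b c → a xor (b xor c) ≡ b xor (a xor c)
xor-exchange a b c = trans (sym (xor-assoc a b c)) (trans (cong (_xor c) (xor-comm a b)) (xor-assoc b a c))

parity-change : (g h : Fin k → Bool) (p : Fin k) → (∀ i → i ≢ p → g i ≡ h i) →
  parity (Vec.tabulate h) ≡ (g p xor h p) xor parity (Vec.tabulate g)
parity-change g h zero agree
  rewrite tabulate-cong {f = g ∘ suc} {g = h ∘ suc} (λ i → agree (suc i) λ ()) =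
  xor-cancel (g zero) (h zero) _
parity-change g h (suc p) agree
  rewrite agree zero (λ ())
        | parity-change (g ∘ suc) (h ∘ suc) p (λ i i≢p → agree (suc i) (i≢p ∘ suc-injective)) =
  xor-exchange (h zero) (g (suc p) xor h (suc p)) (parity (Vec.tabulate (g ∘ suc)))

allSubsets-unique : ∀ k → Unique (allSubsets k)
allSubsets-unique zero = [] ∷ []
allSubsets-unique (suc k) =
  AllPairsₚ.++⁺ (Uniqueₚ.map⁺ ∷-injectiveʳ (allSubsets-unique k))
                (Uniqueₚ.map⁺ ∷-injectiveʳ (allSubsets-unique k))
    (Allₚ.map⁺ (All.universal (λ _ → Allₚ.map⁺ (All.universal (λ _ ()) _)) _))

∈-allSubsets : (I : Subset k) → I ∈ allSubsets k
∈-allSubsets [] = here refl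
∈-allSubsets (inside ∷ I) = ∈-++⁺ˡ (∈-map⁺ (inside ∷_) (∈-allSubsets I))
∈-allSubsets (outside ∷ I) = ∈-++⁺ʳ _ (∈-map⁺ (outside ∷_) (∈-allSubsets I))

options : Side → (m : ℕ) → List (Maybe (Fin m))
options inside m = map just (allFin m)
options outside m = [ nothing ]

options-is-just : ∀ b m → All (λ z → is-just z ≡ b) (options b m)
options-is-just inside m = Allₚ.map⁺ (All.universal (λ _ → refl) _)
options-is-just outside m = refl ∷ []

options-unique : ∀ b m → Unique (options b m)
options-unique inside m = Uniqueₚ.map⁺ just-injective (Uniqueₚ.allFin⁺ m)
options-unique outside m = [] ∷ []

∈-options : (z : Maybe (Fin m)) → z ∈ options (is-just z) m
∈-options nothing = here refl
∈-options (just a) = ∈-map⁺ just (∈-allFin a)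

length-options : (I : Subset k) (n : Fin k → ℕ) →
  Π[i< k ] (λ i → length (options (lookup I i) (n i))) ≡ prodOver k I n
length-options [] n = refl
length-options {suc k} (inside ∷ I) n =
  cong₂ _*_ (trans (length-map just (allFin (n zero))) (length-tabulate {n = n zero} (λ a → a)))
            (trans (Π-tail {k} _) (trans (length-options I (n ∘ suc)) (sym (Π-tail {k} _))))
length-options {suc k} (outside ∷ I) n =
  cong (1 *_) (trans (Π-tail {k} _) (trans (length-options I (n ∘ suc)) (sym (Π-tail {k} _))))

-- A vertex lies in the hub part, in an unmarked (plain) part, or in a marked part, as its centre
-- or as a leaf.
data Role : Set where
  inHub plain centre leaf : Role

-- In `hubbed odd`, `odd` is the parity of the number of marked parts.
data Form : Set where
  multipartite : Form
  hubbed : Bool → Form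

instance
  Role-finite : Finite Role
  Role-finite = record
    { elements = inHub ∷ plain ∷ centre ∷ leaf ∷ []
    ; complete = λ { inHub → here refl ; plain → there (here refl)
                   ; centre → there (there (here refl)) ; leaf → there (there (there (here refl))) } }

  Form-finite : Finite Form
  Form-finite = record
    { elements = multipartite ∷ hubbed true ∷ hubbed false ∷ []
    ; complete = λ { multipartite → here refl ; (hubbed true) → there (here refl)
                   ; (hubbed false) → there (there (here refl)) } }

isHub isPlain isCentre isLeaf : Role → Bool
isHub inHub = true
isHub _ = false
isPlain plain = true
isPlain _ = false
isCentre centre = true
isCentre _ = false
isLeaf leaf = true
isLeaf _ = false

isLeaf⁻¹ : ∀ {r} → isLeaf r ≡ true → r ≡ leaf
isLeaf⁻¹ {leaf} _ = refl

sameRole : Role → Role → Bool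
sameRole inHub inHub = true
sameRole plain plain = true
sameRole centre centre = true
sameRole leaf leaf = true
sameRole _ _ = false

sameRole-refl : ∀ r → T (sameRole r r)
sameRole-refl inHub = _
sameRole-refl plain = _
sameRole-refl centre = _
sameRole-refl leaf = _

sameKind : Role → Role → Bool
sameKind inHub inHub = true
sameKind plain plain = true
sameKind centre centre = true
sameKind centre leaf = true
sameKind leaf centre = true
sameKind leaf leaf = true
sameKind _ _ = false

linked : Form → Role → Role → (samePart : Bool) → Bool
linked multipartite rx ry false = not (isLeaf rx) ∧ not (isLeaf ry)
linked multipartite rx ry true = isCentre rx ∨ isCentre ry
linked (hubbed _) rx ry false = (isHub rx ∧ not (isLeaf ry)) ∨ (isHub ry ∧ not (isLeaf rx))
linked (hubbed odd) rx ry true = if isHub rx then odd else (isPlain rx ∨ (isCentre rx ∨ isCentre ry))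

edge : Form → Role → Role → (samePart sameVertex : Bool) → Bool
edge φ rx ry p e = not e ∧ linked φ rx ry p

leaf-lonely : ∀ φ r → linked φ leaf r false ≡ false
leaf-lonely multipartite r = refl
leaf-lonely (hubbed _) r = ∧-zeroʳ (isHub r)

leaf-centre-linked : ∀ φ → linked φ leaf centre true ≡ true
leaf-centre-linked multipartite = refl
leaf-centre-linked (hubbed _) = refl

leaves-unlinked : ∀ φ → linked φ leaf leaf true ≡ false
leaves-unlinked multipartite = refl
leaves-unlinked (hubbed _) = refl

formAfter : Form → Role → Form
formAfter φ leaf = φ
formAfter multipartite centre = hubbed true
formAfter multipartite _ = hubbed false
formAfter (hubbed _) inHub = multipartite
formAfter (hubbed odd) _ = hubbed (not odd)

centreIf : Bool → Role
centreIf e = if e then centre else leaf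

roleAfter : Form → (rv rx : Role) → (samePart sameVertex : Bool) → Role
roleAfter _ _ rx false _ = rx
roleAfter _ leaf rx true _ = rx
roleAfter multipartite _ _ true _ = inHub
roleAfter (hubbed odd) inHub _ true e = if odd then centreIf e else plain
roleAfter (hubbed _) plain _ true e = centreIf e
roleAfter (hubbed _) centre _ true _ = plain

fits : Form → Role → Bool
fits multipartite r = not (isHub r)
fits (hubbed _) _ = true

coherentPair : Role → Role → (samePart sameVertex : Bool) → Bool
coherentPair ra rb p e =
  (e ⇒ (p ∧ sameRole ra rb)) ∧ ((p ⇒ sameKind ra rb) ∧
  (((p ∧ (isCentre ra ∧ isCentre rb)) ⇒ e) ∧ ((isHub ra ∧ isHub rb) ⇒ p)))

transitive : Bool → Bool → Bool → Bool
transitive pvx pvy pxy = ((pvx ∧ pvy) ⇒ pxy) ∧ (((pvx ∧ pxy) ⇒ pvy) ∧ ((pvy ∧ pxy) ⇒ pvx))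

-- What a local complementation at v sees of a triple (v, x, y): the form, the roles of v, x, y,
-- and for the pairs vx, vy, xy whether they lie in a common part and whether they coincide.
Snapshot : Set
Snapshot = Form × (Role × Role × Role) × (Bool × Bool × Bool) × (Bool × Bool × Bool)

coherent : Snapshot → Bool
coherent (φ , (rv , rx , ry) , (pvx , pvy , pxy) , (evx , evy , exy)) =
  (fits φ rv ∧ (fits φ rx ∧ fits φ ry)) ∧
  ((coherentPair rv rx pvx evx ∧ (coherentPair rv ry pvy evy ∧ coherentPair rx ry pxy exy)) ∧
  transitive pvx pvy pxy)

lcEdge : Snapshot → Bool
lcEdge (φ , (rv , rx , ry) , (pvx , pvy , pxy) , (evx , evy , exy)) =
  if (not exy ∧ (edge φ rv rx pvx evx ∧ edge φ rv ry pvy evy))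
  then not (edge φ rx ry pxy exy) else edge φ rx ry pxy exy

edgeAfter : Snapshot → Bool
edgeAfter (φ , (rv , rx , ry) , (pvx , pvy , pxy) , (evx , evy , exy)) =
  edge (formAfter φ rv) (roleAfter φ rv rx pvx evx) (roleAfter φ rv ry pvy evy) pxy exy

lcEdge≡edgeAfterᵇ : Snapshot → Bool
lcEdge≡edgeAfterᵇ σ = coherent σ ⇒ isYes (lcEdge σ ≟ᵇ edgeAfter σ)

-- Decided by evaluating `lcEdge≡edgeAfterᵇ` on all 12288 snapshots.
lcEdge≡edgeAfter : ∀ σ → T (coherent σ) → lcEdge σ ≡ edgeAfter σ
lcEdge≡edgeAfter σ c =
  toWitness {a? = lcEdge σ ≟ᵇ edgeAfter σ} (⇒-elim {coherent σ} (by-exhaustion lcEdge≡edgeAfterᵇ _ σ) c)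

markRole : Maybe (Fin m) → Fin m → Role
markRole nothing _ = plain
markRole (just c) a = if does (c ≟ a) then centre else leaf

markRole-not-hub : (z : Maybe (Fin m)) (a : Fin m) → isHub (markRole z a) ≡ false
markRole-not-hub nothing a = refl
markRole-not-hub (just c) a with does (c ≟ a)
... | true = refl
... | false = refl

markRole-sameKind : (z : Maybe (Fin m)) (a b : Fin m) → T (sameKind (markRole z a) (markRole z b))
markRole-sameKind nothing a b = tt
markRole-sameKind (just c) a b with does (c ≟ a) | does (c ≟ b)
... | true | true = tt
... | true | false = tt
... | false | true = tt
... | false | false = tt

markRole-centre : (z : Maybe (Fin m)) (a : Fin m) → T (isCentre (markRole z a)) → z ≡ just a
markRole-centre (just c) a _ with c ≟ a
... | yes refl = refl

markRole-centre-self : (c : Fin m) → markRole (just c) c ≡ centre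
markRole-centre-self c rewrite dec-true (c ≟ c) refl = refl

markRole-leaf : {c a : Fin m} → c ≢ a → markRole (just c) a ≡ leaf
markRole-leaf {c = c} {a} c≢a rewrite dec-false (c ≟ a) c≢a = refl

markRole-leaf⁻¹ : (z : Maybe (Fin m)) (a : Fin m) → markRole z a ≡ leaf → ∃ λ c → z ≡ just c
markRole-leaf⁻¹ (just c) a _ = c , refl

markRole-fromMaybe : (a : Fin m) (z : Maybe (Fin m)) → isLeaf (markRole z (fromMaybe a z)) ≡ false
markRole-fromMaybe a nothing = refl
markRole-fromMaybe a (just c) rewrite markRole-centre-self c = refl

module Orbit (k : ℕ) (n : Fin k → ℕ) where

  open ≡-Reasoning

  V : Set
  V = Vtx k n

  samePart : V → V → Bool
  samePart (p , _) (q , _) = does (p ≟ q)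

  Marking : Set
  Marking = (i : Fin k) → Maybe (Fin (n i))

  update : Marking → (p : Fin k) → Maybe (Fin (n p)) → Marking
  update μ p z q with q ≟ p
  ... | yes refl = z
  ... | no _ = μ q

  update-same : ∀ μ p z → update μ p z p ≡ z
  update-same μ p z with p ≟ p
  ... | yes refl = refl
  ... | no p≢p = contradiction refl p≢p

  update-other : ∀ μ {p q} z → q ≢ p → update μ p z q ≡ μ q
  update-other μ {p} {q} z q≢p with q ≟ p
  ... | yes q≡p = contradiction q≡p q≢p
  ... | no _ = refl

  support : Marking → Subset k
  support μ = Vec.tabulate (λ i → is-just (μ i))

  parity-update : ∀ μ p z →
    parity (support (update μ p z)) ≡ (is-just (μ p) xor is-just z) xor parity (support μ)
  parity-update μ p z
    rewrite sym (cong is-just (update-same μ p z)) =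
    parity-change (is-just ∘ μ) _ p (λ i i≢p → cong is-just (sym (update-other μ z i≢p)))

  data State : Set where
    multi : Marking → State
    hubAt : Fin k → Marking → State

  role : State → V → Role
  role (multi μ) (p , a) = markRole (μ p) a
  role (hubAt j μ) (p , a) = if does (p ≟ j) then inHub else markRole (μ p) a

  form : State → Form
  form (multi _) = multipartite
  form (hubAt _ μ) = hubbed (parity (support μ))

  marking : State → Marking
  marking (multi μ) = μ
  marking (hubAt _ μ) = μ

  hubOf : State → Maybe (Fin k)
  hubOf (multi _) = nothing
  hubOf (hubAt j _) = just j

  graph : State → Graph V
  graph s x y = edge (form s) (role s x) (role s y) (samePart x y) (decVtx k n x y)

  Valid : State → Set
  Valid (multi μ) = parity (support μ) ≡ false
  Valid (hubAt j μ) = μ j ≡ nothing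

  lcState : State → V → State
  lcState (multi μ) (p , a) with μ p
  ... | nothing = hubAt p μ
  ... | just c with c ≟ a
  ...   | yes _ = hubAt p (update μ p nothing)
  ...   | no _ = multi μ
  lcState (hubAt j μ) (p , a) with p ≟ j
  ... | yes refl = if parity (support μ) then multi (update μ j (just a)) else multi μ
  ... | no _ with μ p
  ...   | nothing = hubAt j (update μ p (just a))
  ...   | just c with c ≟ a
  ...     | yes _ = hubAt j (update μ p nothing)
  ...     | no _ = hubAt j μ

  same-vertex-sound : ∀ x y → T (decVtx k n x y) → x ≡ y
  same-vertex-sound x y = does-sound (≡-dec _≟_ _≟_ x y)

  same-vertex-complete : ∀ x y → x ≡ y → T (decVtx k n x y)
  same-vertex-complete x y = does-complete (≡-dec _≟_ _≟_ x y)

  role-centre : ∀ s p a → T (isCentre (role s (p , a))) → marking s p ≡ just a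
  role-centre (multi μ) p a = markRole-centre (μ p) a
  role-centre (hubAt j μ) p a with does (p ≟ j)
  ... | true = λ ()
  ... | false = markRole-centre (μ p) a

  role-hub : ∀ s p a → T (isHub (role s (p , a))) → hubOf s ≡ just p
  role-hub (multi μ) p a h = ⊥-elim (subst T (markRole-not-hub (μ p) a) h)
  role-hub (hubAt j μ) p a h with p ≟ j
  ... | yes refl = refl
  ... | no _ = ⊥-elim (subst T (markRole-not-hub (μ p) a) h)

  fits-role : ∀ s x → T (fits (form s) (role s x))
  fits-role (hubAt j μ) x = tt
  fits-role (multi μ) (p , a) rewrite markRole-not-hub (μ p) a = tt

  sameKind-siblings : ∀ s p (a b : Fin (n p)) → T (sameKind (role s (p , a)) (role s (p , b)))
  sameKind-siblings (multi μ) p a b = markRole-sameKind (μ p) a b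
  sameKind-siblings (hubAt j μ) p a b with does (p ≟ j)
  ... | true = tt
  ... | false = markRole-sameKind (μ p) a b

  coherent-pair : ∀ s x y → T (coherentPair (role s x) (role s y) (samePart x y) (decVtx k n x y))
  coherent-pair s (p , a) (q , b) =
    ∧-intro (⇒-intro same-vertex) (∧-intro (⇒-intro same-kind) (∧-intro (⇒-intro centres) (⇒-intro hubs)))
    where
    same-vertex : T (decVtx k n (p , a) (q , b)) → T (does (p ≟ q) ∧ sameRole (role s (p , a)) (role s (q , b)))
    same-vertex e with same-vertex-sound (p , a) (q , b) e
    ... | refl = ∧-intro (does-complete (p ≟ p) refl) (sameRole-refl (role s (p , a)))
    same-kind : T (does (p ≟ q)) → T (sameKind (role s (p , a)) (role s (q , b)))
    same-kind e with does-sound (p ≟ q) e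
    ... | refl = sameKind-siblings s p a b
    centres : T (does (p ≟ q) ∧ (isCentre (role s (p , a)) ∧ isCentre (role s (q , b)))) →
              T (decVtx k n (p , a) (q , b))
    centres t with ∧-elim t
    ... | e , c with does-sound (p ≟ q) e
    ... | refl with ∧-elim {isCentre (role s (p , a))} c
    ... | ca , cb = same-vertex-complete (p , a) (p , b)
      (cong (p ,_) (just-injective (trans (sym (role-centre s p a ca)) (role-centre s p b cb))))
    hubs : T (isHub (role s (p , a)) ∧ isHub (role s (q , b))) → T (does (p ≟ q))
    hubs t with ∧-elim t
    ... | ha , hb = does-complete (p ≟ q) (just-injective (trans (sym (role-hub s p a ha)) (role-hub s q b hb)))

  samePart-transitive : ∀ v x y → T (transitive (samePart v x) (samePart v y) (samePart x y))
  samePart-transitive (p , _) (q , _) (r , _) = ∧-intro (⇒-intro xy) (∧-intro (⇒-intro vy) (⇒-intro vx))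
    where
    xy : T (does (p ≟ q) ∧ does (p ≟ r)) → T (does (q ≟ r))
    xy t with ∧-elim t
    ... | e , e′ with does-sound (p ≟ q) e | does-sound (p ≟ r) e′
    ... | refl | refl = does-complete (p ≟ p) refl
    vy : T (does (p ≟ q) ∧ does (q ≟ r)) → T (does (p ≟ r))
    vy t with ∧-elim t
    ... | e , e′ with does-sound (p ≟ q) e | does-sound (q ≟ r) e′
    ... | refl | refl = does-complete (p ≟ p) refl
    vx : T (does (p ≟ r) ∧ does (q ≟ r)) → T (does (p ≟ q))
    vx t with ∧-elim t
    ... | e , e′ with does-sound (p ≟ r) e | does-sound (q ≟ r) e′
    ... | refl | refl = does-complete (p ≟ p) refl

  snapshot : State → V → V → V → Snapshot
  snapshot s v x y =
    form s , (role s v , role s x , role s y) , (samePart v x , samePart v y , samePart x y) ,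
    (decVtx k n v x , decVtx k n v y , decVtx k n x y)

  coherent-snapshot : ∀ s v x y → T (coherent (snapshot s v x y))
  coherent-snapshot s v x y =
    ∧-intro (∧-intro (fits-role s v) (∧-intro (fits-role s x) (fits-role s y)))
      (∧-intro (∧-intro (coherent-pair s v x) (∧-intro (coherent-pair s v y) (coherent-pair s x y)))
               (samePart-transitive v x y))

  form-lcState : ∀ s → Valid s → ∀ v → form (lcState s v) ≡ formAfter (form s) (role s v)
  form-lcState (multi μ) even (p , a) with μ p in μp
  ... | nothing = cong hubbed even
  ... | just c with c ≟ a
  ...   | yes refl =
    cong hubbed (trans (parity-update μ p nothing) (cong₂ (λ z π → (is-just z xor false) xor π) μp even))
  ...   | no _ = refl
  form-lcState (hubAt j μ) _ (p , a) with p ≟ j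
  ... | yes refl with parity (support μ)
  ...   | true = refl
  ...   | false = refl
  form-lcState (hubAt j μ) _ (p , a) | no _ with μ p in μp
  ...   | nothing =
    cong hubbed (trans (parity-update μ p (just a)) (cong (λ z → (is-just z xor true) xor parity (support μ)) μp))
  ...   | just c with c ≟ a
  ...     | yes refl =
    cong hubbed (trans (parity-update μ p nothing) (cong (λ z → (is-just z xor false) xor parity (support μ)) μp))
  ...     | no _ = refl

  role-lcState-apart : ∀ s → Valid s → ∀ {p q} (a : Fin (n p)) (b : Fin (n q)) → q ≢ p →
    role (lcState s (p , a)) (q , b) ≡ role s (q , b)
  role-lcState-apart (multi μ) _ {p} {q} a b q≢p with μ p
  ... | nothing rewrite dec-false (q ≟ p) q≢p = refl
  ... | just c with c ≟ a
  ...   | yes _ rewrite dec-false (q ≟ p) q≢p | update-other μ nothing q≢p = refl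
  ...   | no _ = refl
  role-lcState-apart (hubAt j μ) _ {p} {q} a b q≢p with p ≟ j
  ... | yes refl with parity (support μ)
  ...   | true rewrite dec-false (q ≟ p) q≢p | update-other μ (just a) q≢p = refl
  ...   | false rewrite dec-false (q ≟ p) q≢p = refl
  role-lcState-apart (hubAt j μ) _ {p} {q} a b q≢p | no _ with μ p
  ...   | nothing rewrite update-other μ (just a) q≢p = refl
  ...   | just c with c ≟ a
  ...     | yes _ rewrite update-other μ nothing q≢p = refl
  ...     | no _ = refl

  role-lcState-sibling : ∀ s → Valid s → ∀ p (a b : Fin (n p)) →
    role (lcState s (p , a)) (p , b) ≡ roleAfter (form s) (role s (p , a)) (role s (p , b)) true (does (a ≟ b))
  role-lcState-sibling (multi μ) _ p a b with μ p in μp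
  ... | nothing rewrite dec-true (p ≟ p) refl = refl
  ... | just c with c ≟ a
  ...   | yes refl rewrite dec-true (p ≟ p) refl = refl
  ...   | no _ rewrite μp = refl
  role-lcState-sibling (hubAt j μ) valid p a b with p ≟ j
  ... | yes refl with parity (support μ)
  ...   | true rewrite update-same μ p (just a) = refl
  ...   | false rewrite valid = refl
  role-lcState-sibling (hubAt j μ) valid p a b | no p≢j with μ p in μp
  ...   | nothing rewrite dec-false (p ≟ j) p≢j | update-same μ p (just a) = refl
  ...   | just c with c ≟ a
  ...     | yes refl rewrite dec-false (p ≟ j) p≢j | update-same μ p nothing = refl
  ...     | no _ rewrite dec-false (p ≟ j) p≢j | μp = refl

  valid-lcState : ∀ s → Valid s → ∀ v → Valid (lcState s v)
  valid-lcState (multi μ) even (p , a) with μ p in μp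
  ... | nothing = μp
  ... | just c with c ≟ a
  ...   | yes _ = update-same μ p nothing
  ...   | no _ = even
  valid-lcState (hubAt j μ) valid (p , a) with p ≟ j
  ... | yes refl with parity (support μ) in odd
  ...   | true = trans (parity-update μ p (just a)) (cong₂ (λ z π → (is-just z xor true) xor π) valid odd)
  ...   | false = odd
  valid-lcState (hubAt j μ) valid (p , a) | no p≢j with μ p
  ...   | nothing = trans (update-other μ (just a) (p≢j ∘ sym)) valid
  ...   | just c with c ≟ a
  ...     | yes _ = trans (update-other μ nothing (p≢j ∘ sym)) valid
  ...     | no _ = valid

  role-lcState : ∀ s → Valid s → ∀ v x →
    role (lcState s v) x ≡ roleAfter (form s) (role s v) (role s x) (samePart v x) (decVtx k n v x)
  role-lcState s valid (p , a) (q , b) with p ≟ q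
  ... | no p≢q = role-lcState-apart s valid a b (p≢q ∘ sym)
  -- ≡-dec compares parts first, so here decVtx k n (p , a) (p , b) reduces to does (a ≟ b).
  ... | yes refl = role-lcState-sibling s valid p a b

  lc-graph : ∀ s → Valid s → ∀ v x y → lc (decVtx k n) v (graph s) x y ≡ graph (lcState s v) x y
  lc-graph s valid v x y
    rewrite form-lcState s valid v | role-lcState s valid v x | role-lcState s valid v y =
    lcEdge≡edgeAfter (snapshot s v x y) (coherent-snapshot s v x y)

  data _≋_ : State → State → Set where
    multi : ∀ {μ ν} → μ ≐ ν → multi μ ≋ multi ν
    hubAt : ∀ {j μ ν} → μ ≐ ν → hubAt j μ ≋ hubAt j ν

  _≉_ : State → State → Set
  s ≉ s′ = ¬ s ≋ s′

  support-cong : ∀ {μ ν} → μ ≐ ν → support μ ≡ support ν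
  support-cong eq = tabulate-cong (λ i → cong is-just (eq i))

  graph-cong : ∀ {s s′} → s ≋ s′ → SameGraph (graph s) (graph s′)
  graph-cong (multi eq) (p , a) (q , b) rewrite eq p | eq q = refl
  graph-cong (hubAt eq) (p , a) (q , b) rewrite eq p | eq q | support-cong eq = refl

  valid-cong : ∀ {s s′} → s ≋ s′ → Valid s → Valid s′
  valid-cong (multi eq) even = trans (cong parity (sym (support-cong eq))) even
  valid-cong (hubAt {j} eq) valid = trans (sym (eq j)) valid

  K : Graph V
  K = completeMultipartite k n

  initial : State
  initial = multi (λ _ → nothing)

  valid-initial : Valid initial
  valid-initial = parity-empty k

  K-initial : SameGraph K (graph initial)
  K-initial (p , a) (q , b) with p ≟ q
  ... | yes refl = sym (∧-zeroʳ _)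
  ... | no _ = refl

  lc-cong : ∀ v {G H : Graph V} → SameGraph G H → SameGraph (lc (decVtx k n) v G) (lc (decVtx k n) v H)
  lc-cong v eq x y rewrite eq v x | eq v y | eq x y = refl

  reachable-valid : ∀ {H} → Reach (decVtx k n) K H → ∃ λ s → Valid s × SameGraph H (graph s)
  reachable-valid base = initial , valid-initial , K-initial
  reachable-valid (step v r) with reachable-valid r
  ... | s , valid , eq =
    lcState s v , valid-lcState s valid v , λ x y → trans (lc-cong v eq x y) (lc-graph s valid v x y)

  -- `lcGraph (v ∷ w) G` complements at v last.
  lcGraph : List V → Graph V → Graph V
  lcGraph [] G = G
  lcGraph (v ∷ w) G = lc (decVtx k n) v (lcGraph w G)

  reach-lcGraph : ∀ w → Reach (decVtx k n) K (lcGraph w K)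
  reach-lcGraph [] = base
  reach-lcGraph (v ∷ w) = step v (reach-lcGraph w)

  record Realises (w : List V) (s : State) : Set where
    constructor realises
    field realised : SameGraph (lcGraph w K) (graph s)

  realises-lc : ∀ {w s} → Valid s → Realises w s → ∀ v → Realises (v ∷ w) (lcState s v)
  realises-lc {s = s} valid (realises r) v = realises λ x y → trans (lc-cong v r x y) (lc-graph s valid v x y)

  realises-cong : ∀ {w s s′} → Realises w s → s ≋ s′ → Realises w s′
  realises-cong (realises r) eq = realises λ x y → trans (r x y) (graph-cong eq x y)

  realises-initial : Realises [] initial
  realises-initial = realises K-initial

  update-redundant : ∀ μ p z → μ p ≡ z → μ ≐ update μ p z
  update-redundant μ p z μp q with q ≟ p
  ... | yes refl = μp
  ... | no _ = refl

  lcState-plain : ∀ {j μ p} (a : Fin (n p)) → p ≢ j → μ p ≡ nothing →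
    lcState (hubAt j μ) (p , a) ≡ hubAt j (update μ p (just a))
  lcState-plain {j} {μ} {p} a p≢j μp with p ≟ j
  ... | yes p≡j = contradiction p≡j p≢j
  ... | no _ rewrite μp = refl

  lcState-hub : ∀ {j μ} (a : Fin (n j)) → parity (support μ) ≡ true →
    lcState (hubAt j μ) (j , a) ≡ multi (update μ j (just a))
  lcState-hub {j} {μ} a odd with j ≟ j
  ... | yes refl rewrite odd = refl
  ... | no j≢j = contradiction refl j≢j

  markedVertices : List (Fin k) → Marking → List V
  markedVertices [] μ = []
  markedVertices (i ∷ is) μ with μ i
  ... | nothing = markedVertices is μ
  ... | just a = (i , a) ∷ markedVertices is μ

  markedVertices-[] : ∀ is μ → markedVertices is μ ≡ [] → ∀ {i} → i ∈ is → μ i ≡ nothing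
  markedVertices-[] (i′ ∷ is) μ none mem with μ i′ in μi′
  markedVertices-[] (i′ ∷ is) μ none (here refl) | nothing = μi′
  markedVertices-[] (i′ ∷ is) μ none (there mem) | nothing = markedVertices-[] is μ none mem

  markedVertices-head : ∀ is μ {i a w} → markedVertices is μ ≡ (i , a) ∷ w → μ i ≡ just a
  markedVertices-head (i′ ∷ is) μ eq with μ i′ in μi′
  ... | nothing = markedVertices-head is μ eq
  markedVertices-head (i′ ∷ is) μ refl | just a = μi′

  fill : List (Fin k) → Marking → Marking → Marking
  fill [] μ ν = ν
  fill (i ∷ is) μ ν = update (fill is μ ν) i (μ i)

  fill-∉ : ∀ {i} is μ ν → i ∉ is → fill is μ ν i ≡ ν i
  fill-∉ [] μ ν _ = refl
  fill-∉ (i′ ∷ is) μ ν i∉ = trans (update-other _ _ (i∉ ∘ here)) (fill-∉ is μ ν (i∉ ∘ there))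

  fill-∈ : ∀ {i} is μ ν → i ∈ is → fill is μ ν i ≡ μ i
  fill-∈ (i′ ∷ is) μ ν (here refl) = update-same _ _ _
  fill-∈ {i} (i′ ∷ is) μ ν (there i∈) with i ≟ i′
  ... | yes refl = refl
  ... | no _ = fill-∈ is μ ν i∈

  fill-nothing : ∀ {j} is μ ν → μ j ≡ nothing → ν j ≡ nothing → fill is μ ν j ≡ nothing
  fill-nothing [] μ ν _ νj = νj
  fill-nothing {j} (i ∷ is) μ ν μj νj with j ≟ i
  ... | yes refl = μj
  ... | no _ = fill-nothing is μ ν μj νj

  realises-fill : ∀ {j w μ ν} → μ j ≡ nothing → ν j ≡ nothing → Realises w (hubAt j ν) →
    ∀ is → Unique is → (∀ {i} → i ∈ is → ν i ≡ nothing) →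
    Realises (markedVertices is μ ++ w) (hubAt j (fill is μ ν))
  realises-fill μj νj r [] _ _ = r
  realises-fill {j} {w} {μ} {ν} μj νj r (i ∷ is) (i∉is ∷ unique) νis = extend
    where
    ρ : Marking
    ρ = fill is μ ν
    ρi : ρ i ≡ nothing
    ρi = trans (fill-∉ is μ ν (Allₚ.All¬⇒¬Any i∉is)) (νis (here refl))
    previous : Realises (markedVertices is μ ++ w) (hubAt j ρ)
    previous = realises-fill μj νj r is unique (νis ∘ there)
    extend : Realises (markedVertices (i ∷ is) μ ++ w) (hubAt j (update ρ i (μ i)))
    extend with μ i in μi
    ... | nothing = realises-cong previous (hubAt (update-redundant ρ i nothing ρi))
    ... | just a = subst (Realises _) (lcState-plain a i≢j ρi)
                     (realises-lc (fill-nothing is μ ν μj νj) previous (i , a))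
      where
      i≢j : i ≢ j
      i≢j refl with trans (sym μi) μj
      ... | ()

  module Realisation (pick : (i : Fin k) → Fin (n i)) where

    hubWord : Fin k → Marking → List V
    hubWord j μ = markedVertices (allFin k) μ ++ [ (j , pick j) ]

    realises-hubWord : ∀ j μ → μ j ≡ nothing → Realises (hubWord j μ) (hubAt j μ)
    realises-hubWord j μ μj =
      realises-cong (realises-fill μj refl hub-created (allFin k) (Uniqueₚ.allFin⁺ k) (λ _ → refl))
                    (hubAt (λ i → fill-∈ (allFin k) μ _ (∈-allFin i)))
      where
      hub-created : Realises [ (j , pick j) ] (hubAt j (λ _ → nothing))
      hub-created = realises-lc valid-initial realises-initial (j , pick j)

    word : State → List V
    word (hubAt j μ) = hubWord j μ
    word (multi μ) with markedVertices (allFin k) μ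
    ... | [] = []
    ... | (i , a) ∷ _ = (i , a) ∷ hubWord i (update μ i nothing)

    realise : State → Graph V
    realise s = lcGraph (word s) K

    realise-graph : ∀ s → Valid s → SameGraph (realise s) (graph s)
    realise-graph (hubAt j μ) valid = Realises.realised (realises-hubWord j μ valid)
    realise-graph (multi μ) even with markedVertices (allFin k) μ in marked
    ... | [] = Realises.realised
      (realises-cong realises-initial (multi λ i → sym (markedVertices-[] (allFin k) μ marked (∈-allFin i))))
    ... | (i , a) ∷ _ =
      Realises.realised (realises-cong
        (subst (Realises _) (lcState-hub a odd)
          (realises-lc (update-same μ i nothing) (realises-hubWord i μ′ (update-same μ i nothing)) (i , a)))
        (multi restored))
      where
      μi : μ i ≡ just a
      μi = markedVertices-head (allFin k) μ marked
      μ′ : Marking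
      μ′ = update μ i nothing
      odd : parity (support μ′) ≡ true
      odd = trans (parity-update μ i nothing) (cong₂ (λ z π → (is-just z xor false) xor π) μi even)
      restored : update μ′ i (just a) ≐ μ
      restored q with q ≟ i
      ... | yes refl = sym μi
      ... | no q≢i = update-other μ nothing q≢i

  graph-apart : ∀ s {p q} (a : Fin (n p)) (b : Fin (n q)) → p ≢ q →
    graph s (p , a) (q , b) ≡ linked (form s) (role s (p , a)) (role s (q , b)) false
  graph-apart s {p} {q} a b p≢q with p ≟ q
  ... | yes p≡q = contradiction p≡q p≢q
  ... | no _ = refl

  graph-siblings : ∀ s p {a b : Fin (n p)} → a ≢ b →
    graph s (p , a) (p , b) ≡ linked (form s) (role s (p , a)) (role s (p , b)) true
  graph-siblings s p {a} {b} a≢b with p ≟ p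
  ... | no p≢p = contradiction refl p≢p
  ... | yes refl with a ≟ b
  ...   | yes a≡b = contradiction a≡b a≢b
  ...   | no _ = refl

  graphs-differ : ∀ s s′ x y → graph s x y ≡ true → graph s′ x y ≡ false →
    ¬ SameGraph (graph s) (graph s′)
  graphs-differ _ _ x y g g′ same with trans (sym g) (trans (same x y) g′)
  ... | ()

  role-leaf⁻¹ : ∀ s p a → role s (p , a) ≡ leaf → ∃ λ c → marking s p ≡ just c
  role-leaf⁻¹ (multi μ) p a = markRole-leaf⁻¹ (μ p) a
  role-leaf⁻¹ (hubAt j μ) p a with p ≟ j
  ... | yes _ = λ ()
  ... | no _ = markRole-leaf⁻¹ (μ p) a

  role-marked : ∀ s → Valid s → ∀ {p c} → marking s p ≡ just c →
    ∀ b → role s (p , b) ≡ markRole (just c) b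
  role-marked (multi μ) _ mark b rewrite mark = refl
  role-marked (hubAt j μ) valid {p} mark b with p ≟ j
  ... | yes refl with trans (sym mark) valid
  ...   | ()
  role-marked (hubAt j μ) valid {p} mark b | no _ rewrite mark = refl

  role-off-hub : ∀ {j μ q} (b : Fin (n q)) → q ≢ j → isHub (role (hubAt j μ) (q , b)) ≡ false
  role-off-hub {j} {μ} {q} b q≢j with q ≟ j
  ... | yes q≡j = contradiction q≡j q≢j
  ... | no _ = markRole-not-hub (μ q) b

  role-hub-part : ∀ {j μ} (b : Fin (n j)) → role (hubAt j μ) (j , b) ≡ inHub
  role-hub-part {j} b rewrite dec-true (j ≟ j) refl = refl

  module Reconstruction (hk : 3 ≤ k) (hn : ∀ i → 2 ≤ n i) where

    nonempty : ∀ i → 0 < n i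
    nonempty i = ≤-trans (s≤s z≤n) (hn i)

    representative : State → (q : Fin k) → Fin (n q)
    representative s q = fromMaybe (fromℕ< (nonempty q)) (marking s q)

    representative-not-leaf : ∀ s q → isLeaf (role s (q , representative s q)) ≡ false
    representative-not-leaf (multi μ) q = markRole-fromMaybe _ (μ q)
    representative-not-leaf (hubAt j μ) q with does (q ≟ j)
    ... | true = refl
    ... | false = markRole-fromMaybe _ (μ q)

    hub-neighbour : ∀ {j μ} (a : Fin (n j)) {q} (b : Fin (n q)) → q ≢ j →
      isLeaf (role (hubAt j μ) (q , b)) ≡ false → graph (hubAt j μ) (j , a) (q , b) ≡ true
    hub-neighbour {j} {μ} a b q≢j notLeaf
      rewrite graph-apart (hubAt j μ) a b (q≢j ∘ sym) | role-hub-part {j} {μ} a | notLeaf = refl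

    neighbour-of-hub : ∀ {j μ p} (a : Fin (n p)) (b : Fin (n j)) → p ≢ j →
      isLeaf (role (hubAt j μ) (p , a)) ≡ false → graph (hubAt j μ) (p , a) (j , b) ≡ true
    neighbour-of-hub {j} {μ} a b p≢j notLeaf
      rewrite graph-apart (hubAt j μ) a b p≢j | role-hub-part {j} {μ} b | role-off-hub {j} {μ} a p≢j | notLeaf =
      refl

    outside-neighbour : ∀ s p (a : Fin (n p)) → isLeaf (role s (p , a)) ≡ false →
      ∃ λ y → proj₁ y ≢ p × graph s (p , a) y ≡ true
    outside-neighbour (multi μ) p a notLeaf =
      (q , representative (multi μ) q) , q≢p ,
      trans (graph-apart (multi μ) a _ (q≢p ∘ sym))
            (cong₂ (λ l l′ → not l ∧ not l′) notLeaf (representative-not-leaf (multi μ) q))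
      where
      q : Fin k
      q = proj₁ (fin-avoid₂ hk p p)
      q≢p : q ≢ p
      q≢p = proj₁ (proj₂ (fin-avoid₂ hk p p))
    outside-neighbour (hubAt j μ) p a notLeaf = neighbour-in-hubAt (p ≟ j) a notLeaf
      where
      neighbour-in-hubAt : ∀ {p} → Dec (p ≡ j) → (a : Fin (n p)) →
        isLeaf (role (hubAt j μ) (p , a)) ≡ false → ∃ λ y → proj₁ y ≢ p × graph (hubAt j μ) (p , a) y ≡ true
      neighbour-in-hubAt (yes refl) a _ =
        (q , representative (hubAt j μ) q) , q≢j , hub-neighbour a _ q≢j (representative-not-leaf (hubAt j μ) q)
        where
        q : Fin k
        q = proj₁ (fin-avoid₂ hk j j)
        q≢j : q ≢ j
        q≢j = proj₁ (proj₂ (fin-avoid₂ hk j j))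
      neighbour-in-hubAt (no p≢j) a notLeaf =
        (j , fromℕ< (nonempty j)) , p≢j ∘ sym , neighbour-of-hub a _ p≢j notLeaf

    leaf-determined : ∀ s s′ → SameGraph (graph s) (graph s′) → ∀ p (a : Fin (n p)) →
      role s (p , a) ≡ leaf → role s′ (p , a) ≡ leaf
    leaf-determined s s′ same p a leafHere with isLeaf (role s′ (p , a)) in leaf′
    ... | true = isLeaf⁻¹ leaf′
    ... | false with outside-neighbour s′ p a leaf′
    ...   | y , q≢p , linked′ =
      ⊥-elim (graphs-differ s′ s (p , a) y linked′ lonely (λ u w → sym (same u w)))
      where
      lonely : graph s (p , a) y ≡ false
      lonely rewrite graph-apart s a (proj₂ y) (q≢p ∘ sym) | leafHere = leaf-lonely (form s) _

    centre-determined : ∀ {s s′} → Valid s → Valid s′ → SameGraph (graph s) (graph s′) →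
      ∀ {p c} → marking s p ≡ just c → marking s′ p ≡ just c
    centre-determined {s} {s′} valid valid′ same {p} {c} mark = recover (role-leaf⁻¹ s′ p a a-leaf′)
      where
      a : Fin (n p)
      a = proj₁ (fin-avoid (hn p) c)
      a≢c : a ≢ c
      a≢c = proj₂ (fin-avoid (hn p) c)
      a-leaf : role s (p , a) ≡ leaf
      a-leaf = trans (role-marked s valid mark a) (markRole-leaf (a≢c ∘ sym))
      a-leaf′ : role s′ (p , a) ≡ leaf
      a-leaf′ = leaf-determined s s′ same p a a-leaf
      star : graph s (p , a) (p , c) ≡ true
      star rewrite graph-siblings s p a≢c | a-leaf | role-marked s valid mark c | markRole-centre-self c =
        leaf-centre-linked (form s)
      recover : (∃ λ c′ → marking s′ p ≡ just c′) → marking s′ p ≡ just c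
      recover (c′ , mark′) with c′ ≟ c
      ... | yes refl = mark′
      ... | no c′≢c = ⊥-elim (graphs-differ s s′ (p , a) (p , c) star unlinked same)
        where
        unlinked : graph s′ (p , a) (p , c) ≡ false
        unlinked rewrite graph-siblings s′ p a≢c | a-leaf′ | role-marked s′ valid′ mark′ c | markRole-leaf c′≢c =
          leaves-unlinked (form s′)

    marking-determined : ∀ s s′ → Valid s → Valid s′ → SameGraph (graph s) (graph s′) →
      marking s ≐ marking s′
    marking-determined s s′ valid valid′ same p with marking s p in mark
    ... | just c = sym (centre-determined valid valid′ same mark)
    ... | nothing with marking s′ p in mark′
    ...   | nothing = refl
    ...   | just c′ with trans (sym mark) (centre-determined valid′ valid (λ x y → sym (same x y)) mark′)
    ...     | ()

    multi≉hubAt : ∀ μ j ν → ¬ SameGraph (graph (multi μ)) (graph (hubAt j ν))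
    multi≉hubAt μ j ν = graphs-differ (multi μ) (hubAt j ν) x y linked-multi unlinked-hub
      where
      q₁ q₂ : Fin k
      q₁ = proj₁ (fin-avoid₂ hk j j)
      q₂ = proj₁ (fin-avoid₂ hk j q₁)
      q₁≢j : q₁ ≢ j
      q₁≢j = proj₁ (proj₂ (fin-avoid₂ hk j j))
      q₂≢j : q₂ ≢ j
      q₂≢j = proj₁ (proj₂ (fin-avoid₂ hk j q₁))
      q₂≢q₁ : q₂ ≢ q₁
      q₂≢q₁ = proj₂ (proj₂ (fin-avoid₂ hk j q₁))
      x y : V
      x = q₁ , representative (multi μ) q₁
      y = q₂ , representative (multi μ) q₂
      linked-multi : graph (multi μ) x y ≡ true
      linked-multi rewrite graph-apart (multi μ) (proj₂ x) (proj₂ y) (q₂≢q₁ ∘ sym)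
                         | representative-not-leaf (multi μ) q₁ | representative-not-leaf (multi μ) q₂ = refl
      unlinked-hub : graph (hubAt j ν) x y ≡ false
      unlinked-hub rewrite graph-apart (hubAt j ν) (proj₂ x) (proj₂ y) (q₂≢q₁ ∘ sym)
                         | role-off-hub {j} {ν} (proj₂ x) q₁≢j | role-off-hub {j} {ν} (proj₂ y) q₂≢j = refl

    hubAt≉hubAt : ∀ {j j′} μ ν → j ≢ j′ → ¬ SameGraph (graph (hubAt j μ)) (graph (hubAt j′ ν))
    hubAt≉hubAt {j} {j′} μ ν j≢j′ = graphs-differ (hubAt j μ) (hubAt j′ ν) x y linked-hub unlinked-hub
      where
      q : Fin k
      q = proj₁ (fin-avoid₂ hk j j′)
      q≢j : q ≢ j
      q≢j = proj₁ (proj₂ (fin-avoid₂ hk j j′))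
      q≢j′ : q ≢ j′
      q≢j′ = proj₂ (proj₂ (fin-avoid₂ hk j j′))
      x y : V
      x = j , fromℕ< (nonempty j)
      y = q , representative (hubAt j μ) q
      linked-hub : graph (hubAt j μ) x y ≡ true
      linked-hub = hub-neighbour (proj₂ x) (proj₂ y) q≢j (representative-not-leaf (hubAt j μ) q)
      unlinked-hub : graph (hubAt j′ ν) x y ≡ false
      unlinked-hub rewrite graph-apart (hubAt j′ ν) (proj₂ x) (proj₂ y) (q≢j ∘ sym)
                         | role-off-hub {j′} {ν} (proj₂ x) j≢j′ | role-off-hub {j′} {ν} (proj₂ y) q≢j′ = refl

    reconstruct : ∀ {s s′} → Valid s → Valid s′ → SameGraph (graph s) (graph s′) → s ≋ s′
    reconstruct {multi μ} {multi ν} valid valid′ same =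
      multi (marking-determined (multi μ) (multi ν) valid valid′ same)
    reconstruct {multi μ} {hubAt j ν} _ _ same = ⊥-elim (multi≉hubAt μ j ν same)
    reconstruct {hubAt j μ} {multi ν} _ _ same = ⊥-elim (multi≉hubAt ν j μ (λ x y → sym (same x y)))
    reconstruct {hubAt j μ} {hubAt j′ ν} valid valid′ same with j ≟ j′
    ... | yes refl = hubAt (marking-determined (hubAt j μ) (hubAt j ν) valid valid′ same)
    ... | no j≢j′ = ⊥-elim (hubAt≉hubAt μ ν j≢j′ same)

  markingsWithSupport : Subset k → List Marking
  markingsWithSupport I = choiceFunctions (λ i → options (lookup I i) (n i))

  hubOptions : Fin k → (i : Fin k) → List (Maybe (Fin (n i)))
  hubOptions j i = if does (i ≟ j) then [ nothing ] else nothing ∷ map just (allFin (n i))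

  multiBlock : Subset k → List State
  multiBlock I = map multi (markingsWithSupport I)

  hubBlock : Fin k → List State
  hubBlock j = map (hubAt j) (choiceFunctions (hubOptions j))

  multiStates hubStates states : List State
  multiStates = concatMap multiBlock (evenSubsets k)
  hubStates = concatMap hubBlock (allFin k)
  states = multiStates ++ hubStates

  support-markingsWithSupport : ∀ I → All (λ μ → support μ ≡ I) (markingsWithSupport I)
  support-markingsWithSupport I =
    All.map (λ supp → trans (tabulate-cong supp) (tabulate∘lookup I))
            (choiceFunctions-all _ (λ i → options-is-just (lookup I i) (n i)))

  hubOptions-at-hub : ∀ j i → All (λ z → i ≡ j → z ≡ nothing) (hubOptions j i)
  hubOptions-at-hub j i with i ≟ j
  ... | yes _ = (λ _ → refl) ∷ []
  ... | no i≢j = All.universal (λ _ i≡j → contradiction i≡j i≢j) _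

  hubOptions-unique : ∀ j i → Unique (hubOptions j i)
  hubOptions-unique j i with does (i ≟ j)
  ... | true = [] ∷ []
  ... | false = Allₚ.map⁺ (All.universal (λ _ ()) _) ∷ options-unique inside (n i)

  states-valid : All Valid states
  states-valid =
    Allₚ.++⁺ (Allₚ.concat⁺ (Allₚ.map⁺ (All.map (λ {I} → multiBlock-valid {I})
                                                (Allₚ.all-filter _ (allSubsets k)))))
             (Allₚ.concat⁺ (Allₚ.map⁺ (All.universal hubBlock-valid (allFin k))))
    where
    multiBlock-valid : ∀ {I} → ∣ I ∣ % 2 ≡ 0 → All Valid (multiBlock I)
    multiBlock-valid {I} even =
      Allₚ.map⁺ (All.map (λ supp → trans (cong parity supp) (even⇒parity-false I even))
                         (support-markingsWithSupport I))
    hubBlock-valid : ∀ j → All Valid (hubBlock j)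
    hubBlock-valid j = Allₚ.map⁺ (All.map (λ atHub → atHub j refl) (choiceFunctions-all _ (hubOptions-at-hub j)))

  multiStates-distinct : AllPairs _≉_ multiStates
  multiStates-distinct = AllPairs-concatMap multiBlock (All.universal within (evenSubsets k))
                                            (AllPairs.map across (AllPairsₚ.filter⁺ _ (allSubsets-unique k)))
    where
    within : ∀ I → AllPairs _≉_ (multiBlock I)
    within I = AllPairsₚ.map⁺ (AllPairs.map (λ μ≉ν → λ { (multi μ≐ν) → μ≉ν μ≐ν })
                                            (choiceFunctions-unique _ (λ i → options-unique (lookup I i) (n i))))
    across : ∀ {I I′} → I ≢ I′ → All (λ s → All (s ≉_) (multiBlock I′)) (multiBlock I)
    across I≢I′ =
      Allₚ.map⁺ (All.map (λ supp → Allₚ.map⁺ (All.map (λ supp′ → λ { (multi μ≐ν) →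
                   I≢I′ (trans (sym supp) (trans (support-cong μ≐ν) supp′)) })
                 (support-markingsWithSupport _))) (support-markingsWithSupport _))

  hubStates-distinct : AllPairs _≉_ hubStates
  hubStates-distinct = AllPairs-concatMap hubBlock (All.universal within (allFin k)) (AllPairsₚ.tabulate⁺ across)
    where
    within : ∀ j → AllPairs _≉_ (hubBlock j)
    within j = AllPairsₚ.map⁺ (AllPairs.map (λ μ≉ν → λ { (hubAt μ≐ν) → μ≉ν μ≐ν })
                                            (choiceFunctions-unique _ (hubOptions-unique j)))
    across : ∀ {j j′} → j ≢ j′ → All (λ s → All (s ≉_) (hubBlock j′)) (hubBlock j)
    across j≢j′ =
      Allₚ.map⁺ (All.universal (λ _ → Allₚ.map⁺ (All.universal (λ { _ (hubAt _) → j≢j′ refl }) _)) _)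

  multi≉hubStates : ∀ μ → All (multi μ ≉_) hubStates
  multi≉hubStates μ =
    Allₚ.concat⁺ (Allₚ.map⁺ (All.universal (λ j → Allₚ.map⁺ (All.universal (λ _ ()) _)) (allFin k)))

  states-distinct : AllPairs _≉_ states
  states-distinct = AllPairsₚ.++⁺ multiStates-distinct hubStates-distinct
    (Allₚ.concat⁺ (Allₚ.map⁺ (All.universal (λ I → Allₚ.map⁺ (All.universal multi≉hubStates _))
                                            (evenSubsets k))))

  states-complete : ∀ s → Valid s → Any (s ≋_) states
  states-complete (multi μ) even =
    Anyₚ.++⁺ˡ
      (Anyₚ.concat⁺ (Anyₚ.map⁺ (Any.map (λ { refl → Anyₚ.map⁺ (Any.map multi listed) }) support-even)))
    where
    support-even : support μ ∈ evenSubsets k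
    support-even =
      ∈-filter⁺ (λ I → (∣ I ∣ % 2) ℕ.≟ 0) (∈-allSubsets (support μ)) (parity-false⇒even (support μ) even)
    listed : Any (μ ≐_) (markingsWithSupport (support μ))
    listed = choiceFunctions-complete _ μ λ i →
      subst (λ b → μ i ∈ options b (n i)) (sym (lookup∘tabulate _ i)) (∈-options (μ i))
  states-complete (hubAt j μ) valid =
    Anyₚ.++⁺ʳ multiStates
      (Anyₚ.concat⁺ (Anyₚ.map⁺ (Any.map (λ { refl → Anyₚ.map⁺ (Any.map hubAt listed) }) (∈-allFin j))))
    where
    option : ∀ i → μ i ∈ hubOptions j i
    option i with i ≟ j
    ... | yes refl = here valid
    ... | no _ with μ i
    ...   | nothing = here refl
    ...   | just a = there (∈-map⁺ just (∈-allFin a))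
    listed : Any (μ ≐_) (choiceFunctions (hubOptions j))
    listed = choiceFunctions-complete _ μ option

  length-multiBlock : ∀ I → length (multiBlock I) ≡ prodOver k I n
  length-multiBlock I = begin
    length (multiBlock I)                                 ≡⟨ length-map multi (markingsWithSupport I) ⟩
    length (markingsWithSupport I)                        ≡⟨ length-choiceFunctions (λ i → options (lookup I i) (n i)) ⟩
    Π[i< k ] (λ i → length (options (lookup I i) (n i)))  ≡⟨ length-options I n ⟩
    prodOver k I n                                        ∎

  length-hubOptions : ∀ j i → length (hubOptions j i) ≡ (if does (i ≟ j) then 1 else suc (n i))
  length-hubOptions j i with does (i ≟ j)
  ... | true = refl
  ... | false = cong suc (trans (length-map just (allFin (n i))) (length-tabulate {n = n i} (λ a → a)))

  length-hubBlock : ∀ j → length (hubBlock j) ≡ Π[i< k ] (λ i → if does (i ≟ j) then 1 else suc (n i))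
  length-hubBlock j = begin
    length (hubBlock j)                           ≡⟨ length-map (hubAt j) (choiceFunctions (hubOptions j)) ⟩
    length (choiceFunctions (hubOptions j))       ≡⟨ length-choiceFunctions (hubOptions j) ⟩
    Π[i< k ] (length ∘ hubOptions j)              ≡⟨ cong product (map-cong (length-hubOptions j) (allFin k)) ⟩
    Π[i< k ] (λ i → if does (i ≟ j) then 1 else suc (n i)) ∎

  length-states : length states ≡ orbitFormula k n
  length-states = begin
    length (multiStates ++ hubStates)
      ≡⟨ length-++ multiStates ⟩
    length multiStates + length hubStates
      ≡⟨ cong₂ _+_ (length-concatMap multiBlock (evenSubsets k)) (length-concatMap hubBlock (allFin k)) ⟩
    sum (map (length ∘ multiBlock) (evenSubsets k)) + sum (map (length ∘ hubBlock) (allFin k))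
      ≡⟨ cong₂ _+_ (cong sum (map-cong length-multiBlock (evenSubsets k)))
                   (cong sum (map-cong length-hubBlock (allFin k))) ⟩
    orbitFormula k n
      ∎

  orbitSize : 3 ≤ k → (∀ i → 2 ≤ n i) → OrbitSize (decVtx k n) K (orbitFormula k n)
  orbitSize hk hn =
    map realise states ,
    trans (length-map realise states) length-states ,
    Allₚ.map⁺ (All.universal (reach-lcGraph ∘ word) states) ,
    AllPairsₚ.map⁺ (AllPairs-restrict states-valid states-distinct different-graphs) ,
    reached-listed
    where
    open Reconstruction hk hn
    open Realisation (λ i → fromℕ< (nonempty i))
    different-graphs : ∀ {s s′} → Valid s → Valid s′ → s ≉ s′ → ¬ SameGraph (realise s) (realise s′)
    different-graphs {s} {s′} valid valid′ s≉s′ same = s≉s′ (reconstruct valid valid′ λ x y →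
      trans (sym (realise-graph s valid x y)) (trans (same x y) (realise-graph s′ valid′ x y)))
    reached-listed : ∀ H → Reach (decVtx k n) K H → Any (SameGraph H) (map realise states)
    reached-listed H r with reachable-valid r
    ... | s , valid , H≈s = Anyₚ.map⁺ (Any.map (λ {s′} s≋s′ x y →
          trans (H≈s x y) (trans (graph-cong s≋s′ x y) (sym (realise-graph s′ (valid-cong s≋s′ valid) x y))))
          (states-complete s valid))

theorem7 : (k : ℕ) → 3 ≤ k → (n : Fin k → ℕ) → (∀ i → 2 ≤ n i) →
    OrbitSize (decVtx k n) (completeMultipartite k n) (orbitFormula k n)
theorem7 k hk n hn = Orbit.orbitSize k n hk hn
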